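{- Let $\mathcal{V}$ be a subvariety of $\mathcal{H}$ and $t(x)$ a unary term. Then $t(x)$ is a nucleus on $\mathcal{V}$ if and only if $\mathcal{V}\models t(x)\approx s(x)$ for some $s(x)\in\{x,\neg\neg x,\top\}$.
   Context: A residuated lattice is an algebra $\mathbf{A}=\langle A,\wedge,\vee,\cdot,\to,\bot,\top\rangle$ such that $\langle A,\wedge,\vee,\bot,\top\rangle$ is a bounded lattice, $\langle A,\cdot,\top\rangle$ is a commutative monoid, and $a\cdot b\le c$ iff $a\le b\to c$. $\neg x:=x\to\bot$. $\mathcal{H}$ is the variety of residuated lattices satisfying $x^2\approx x$ (Heyting algebras). A nucleus on $\mathbf{A}$ is a map $\gamma:A\to A$ with $a\le\gamma(a)$, $a\le b\Rightarrow\gamma(a)\le\gamma(b)$, $\gamma(\gamma(a))=\gamma(a)$ and $\gamma(a)\cdot\gamma(b)\le\gamma(a\cdot b)$. A term $t(x)$ is a nucleus on $\mathcal{V}$ if $t^{\mathbf{A}}$ is a nucleus on $\mathbf{A}$ for every $\mathbf{A}\in\mathcal{V}$. -}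

module Defs where

open import Data.Nat using (ℕ)
open import Data.Unit using (⊤; tt)
open import Data.Product using (_×_; _,_)
open import Data.Sum using (_⊎_)
open import Relation.Binary.PropositionalEquality using (_≡_)

record ResLattice : Set₁ where
  infixr 6 _∧_
  infixr 5 _∨_
  infixl 7 _·_
  infixr 4 _⇒_
  infix  3 _≤_
  field
    Carrier : Set
    _∧_ _∨_ _·_ _⇒_ : Carrier → Carrier → Carrier
    bot top : Carrier
    ∧-comm  : ∀ a b → a ∧ b ≡ b ∧ a
    ∧-assoc : ∀ a b c → (a ∧ b) ∧ c ≡ a ∧ (b ∧ c)
    ∨-comm  : ∀ a b → a ∨ b ≡ b ∨ a
    ∨-assoc : ∀ a b c → (a ∨ b) ∨ c ≡ a ∨ (b ∨ c)
    ∧-absorbs-∨ : ∀ a b → a ∧ (a ∨ b) ≡ a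
    ∨-absorbs-∧ : ∀ a b → a ∨ (a ∧ b) ≡ a
    bot-least : ∀ a → bot ∧ a ≡ bot
    top-greatest : ∀ a → a ∧ top ≡ a
    ·-assoc : ∀ a b c → (a · b) · c ≡ a · (b · c)
    ·-comm  : ∀ a b → a · b ≡ b · a
    ·-identity : ∀ a → a · top ≡ a
  _≤_ : Carrier → Carrier → Set
  a ≤ b = a ∧ b ≡ a
  field
    residuate   : ∀ a b c → a · b ≤ c → a ≤ b ⇒ c
    unresiduate : ∀ a b c → a ≤ b ⇒ c → a · b ≤ c

  ¬_ : Carrier → Carrier
  ¬ a = a ⇒ bot

IsHeyting : ResLattice → Set
IsHeyting A = ∀ a → a · a ≡ a
  where open ResLattice A

data Term (X : Set) : Set where
  var : X → Term X
  _∧ₜ_ _∨ₜ_ _·ₜ_ _⇒ₜ_ : Term X → Term X → Term X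
  ⊥ₜ ⊤ₜ : Term X

⟦_⟧ : {X : Set} → Term X → (A : ResLattice) → (X → ResLattice.Carrier A) → ResLattice.Carrier A
⟦ var x ⟧ A ρ = ρ x
⟦ s ∧ₜ t ⟧ A ρ = ResLattice._∧_ A (⟦ s ⟧ A ρ) (⟦ t ⟧ A ρ)
⟦ s ∨ₜ t ⟧ A ρ = ResLattice._∨_ A (⟦ s ⟧ A ρ) (⟦ t ⟧ A ρ)
⟦ s ·ₜ t ⟧ A ρ = ResLattice._·_ A (⟦ s ⟧ A ρ) (⟦ t ⟧ A ρ)
⟦ s ⇒ₜ t ⟧ A ρ = ResLattice._⇒_ A (⟦ s ⟧ A ρ) (⟦ t ⟧ A ρ)
⟦ ⊥ₜ ⟧ A ρ = ResLattice.bot A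
⟦ ⊤ₜ ⟧ A ρ = ResLattice.top A

Equation : Set
Equation = Term ℕ × Term ℕ

_⊨_ : ResLattice → Equation → Set
A ⊨ (s , t) = ∀ (ρ : ℕ → ResLattice.Carrier A) → ⟦ s ⟧ A ρ ≡ ⟦ t ⟧ A ρ

-- A subvariety of 𝓗 is given (Birkhoff) by a set E of equations:
-- its members are the Heyting algebras satisfying every equation in E.
SubvarietyOfH : Set₁
SubvarietyOfH = Equation → Set

_∈V_ : ResLattice → SubvarietyOfH → Set
A ∈V E = IsHeyting A × (∀ e → E e → A ⊨ e)

UnaryTerm : Set
UnaryTerm = Term ⊤

x : UnaryTerm
x = var tt

¬¬x : UnaryTerm
¬¬x = (x ⇒ₜ ⊥ₜ) ⇒ₜ ⊥ₜ

op : UnaryTerm → (A : ResLattice) → ResLattice.Carrier A → ResLattice.Carrier A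
op t A a = ⟦ t ⟧ A (λ _ → a)

IsNucleus : (A : ResLattice) → (ResLattice.Carrier A → ResLattice.Carrier A) → Set
IsNucleus A γ =
    (∀ a → a ≤ γ a)
  × (∀ a b → a ≤ b → γ a ≤ γ b)
  × (∀ a → γ (γ a) ≡ γ a)
  × (∀ a b → γ a · γ b ≤ γ (a · b))
  where open ResLattice A

IsNucleusOn : SubvarietyOfH → UnaryTerm → Set₁
IsNucleusOn V t = ∀ (A : ResLattice) → A ∈V V → IsNucleus A (op t A)

_⊨ᵤ_≈_ : SubvarietyOfH → UnaryTerm → UnaryTerm → Set₁
V ⊨ᵤ t ≈ s = ∀ (A : ResLattice) → A ∈V V → ∀ a → op t A a ≡ op s A a

{-# OPTIONS --safe #-}
module Submission where

-- In a Heyting algebra every term operation respects the principal-filter congruences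
-- c ∧ a = c ∧ b, and for a dense d (¬ d = ⊥) the map ⊥ < ½ < ⊤ ↦ ⊥, d, ⊤ is a homomorphism
-- from the three-element chain. Let t be inflationary and monotone. With d = ⊤, t(⊥) is the
-- image of the chain value t(⊥); if that is not ⊥ then t(⊥) = ⊤ and t is constantly ⊤.
-- Otherwise ¬ a ∧ t(a) = ¬ a ∧ t(⊥) = ⊥, so t(a) ≤ ¬¬a; and as a = ¬¬a ∧ d for the dense
-- element d = ¬¬a → a, we get t(a) = ¬¬a ∧ t(d), where t(d) ∈ {⊥, d, ⊤} is the image of the
-- chain value t(½). This gives t(a) = a, t(a) = ¬¬a, or t(a) = ⊥, which by inflationarity
-- forces a = ⊥ = t(a); the case depends only on t, not on the algebra.

open import Defs
open import Algebra.Core using (Op₂)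
open import Data.Product using (_×_; _,_)
open import Data.Sum using (_⊎_; inj₁; inj₂)
open import Function using (_∘_)
open import Level using (0ℓ)
open import Relation.Binary.Lattice
  using (Infimum; Supremum; BoundedLattice; HeytingAlgebra)
open import Relation.Binary.Structures using (IsPartialOrder)
open import Relation.Binary.PropositionalEquality
  using (_≡_; refl; sym; trans; cong; cong₂; subst; subst₂; isEquivalence; _≗_; module ≡-Reasoning)
import Relation.Binary.Lattice.Properties.HeytingAlgebra as HeytingAlgebraProperties
import Relation.Binary.Lattice.Properties.BoundedJoinSemilattice as BoundedJoinSemilatticeProperties
import Relation.Binary.Lattice.Properties.BoundedMeetSemilattice as BoundedMeetSemilatticeProperties
import Relation.Binary.Lattice.Properties.BoundedLattice as BoundedLatticeProperties
import Relation.Binary.Lattice.Properties.JoinSemilattice as JoinSemilatticeProperties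
import Relation.Binary.Lattice.Properties.MeetSemilattice as MeetSemilatticeProperties
import Relation.Binary.Reasoning.PartialOrder as ≤-Reasoning

data Chain₃ : Set where
  ⊥₃ ½₃ ⊤₃ : Chain₃

infixr 6 _∧₃_
infixr 5 _∨₃_
infixr 4 _⇒₃_

_∧₃_ : Chain₃ → Chain₃ → Chain₃
⊥₃ ∧₃ _  = ⊥₃
½₃ ∧₃ ⊥₃ = ⊥₃
½₃ ∧₃ _  = ½₃
⊤₃ ∧₃ j  = j

_∨₃_ : Chain₃ → Chain₃ → Chain₃
⊥₃ ∨₃ j  = j
½₃ ∨₃ ⊤₃ = ⊤₃
½₃ ∨₃ _  = ½₃
⊤₃ ∨₃ _  = ⊤₃

_⇒₃_ : Chain₃ → Chain₃ → Chain₃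
⊥₃ ⇒₃ _  = ⊤₃
½₃ ⇒₃ ⊥₃ = ⊥₃
½₃ ⇒₃ _  = ⊤₃
⊤₃ ⇒₃ j  = j

⟦_⟧₃ : {X : Set} → Term X → (X → Chain₃) → Chain₃
⟦ var v ⟧₃  σ = σ v
⟦ s ∧ₜ u ⟧₃ σ = ⟦ s ⟧₃ σ ∧₃ ⟦ u ⟧₃ σ
⟦ s ∨ₜ u ⟧₃ σ = ⟦ s ⟧₃ σ ∨₃ ⟦ u ⟧₃ σ
⟦ s ·ₜ u ⟧₃ σ = ⟦ s ⟧₃ σ ∧₃ ⟦ u ⟧₃ σ
⟦ s ⇒ₜ u ⟧₃ σ = ⟦ s ⟧₃ σ ⇒₃ ⟦ u ⟧₃ σ
⟦ ⊥ₜ ⟧₃     σ = ⊥₃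
⟦ ⊤ₜ ⟧₃     σ = ⊤₃

_at₃_ : UnaryTerm → Chain₃ → Chain₃
t at₃ i = ⟦ t ⟧₃ (λ _ → i)

-- Arguments are t(⊥) and t(½) in the chain. For an inflationary t the pair (⊥, ⊥) only
-- arises in trivial algebras, where x is as good a normal form as any.
nucleusNormalForm : Chain₃ → Chain₃ → UnaryTerm
nucleusNormalForm ⊥₃ ⊤₃ = ¬¬x
nucleusNormalForm ⊥₃ _  = x
nucleusNormalForm _  _  = ⊤ₜ

module ResLatticeProperties (A : ResLattice) where
  open ResLattice A

  ∧-idem : ∀ a → a ∧ a ≡ a
  ∧-idem a = begin
    a ∧ a             ≡⟨ cong (a ∧_) (∨-absorbs-∧ a a) ⟨
    a ∧ (a ∨ a ∧ a)   ≡⟨ ∧-absorbs-∨ a (a ∧ a) ⟩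
    a                 ∎
    where open ≡-Reasoning

  ≤-isPartialOrder : IsPartialOrder _≡_ _≤_
  ≤-isPartialOrder = record
    { isPreorder = record
      { isEquivalence = isEquivalence
      ; reflexive     = λ { {a} refl → ∧-idem a }
      ; trans         = ≤-trans
      }
    ; antisym = ≤-antisym
    }
    where
    open ≡-Reasoning
    ≤-trans : ∀ {a b c} → a ≤ b → b ≤ c → a ≤ c
    ≤-trans {a} {b} {c} a≤b b≤c = begin
      a ∧ c         ≡⟨ cong (_∧ c) a≤b ⟨
      (a ∧ b) ∧ c   ≡⟨ ∧-assoc a b c ⟩
      a ∧ (b ∧ c)   ≡⟨ cong (a ∧_) b≤c ⟩
      a ∧ b         ≡⟨ a≤b ⟩
      a             ∎
    ≤-antisym : ∀ {a b} → a ≤ b → b ≤ a → a ≡ b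
    ≤-antisym {a} {b} a≤b b≤a = trans (sym a≤b) (trans (∧-comm a b) b≤a)

  ∧-infimum : Infimum _≤_ _∧_
  ∧-infimum a b = a∧b≤a , a∧b≤b , λ _ → ≤-∧
    where
    open ≡-Reasoning
    ≤-∧ : ∀ {c} → c ≤ a → c ≤ b → c ≤ a ∧ b
    ≤-∧ {c} c≤a c≤b = trans (sym (∧-assoc c a b)) (trans (cong (_∧ b) c≤a) c≤b)
    a∧b≤a : a ∧ b ≤ a
    a∧b≤a = begin
      (a ∧ b) ∧ a   ≡⟨ cong (_∧ a) (∧-comm a b) ⟩
      (b ∧ a) ∧ a   ≡⟨ ∧-assoc b a a ⟩
      b ∧ (a ∧ a)   ≡⟨ cong (b ∧_) (∧-idem a) ⟩
      b ∧ a         ≡⟨ ∧-comm b a ⟩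
      a ∧ b         ∎
    a∧b≤b : a ∧ b ≤ b
    a∧b≤b = trans (∧-assoc a b b) (cong (a ∧_) (∧-idem b))

  ∨-supremum : Supremum _≤_ _∨_
  ∨-supremum a b = ∧-absorbs-∨ a b , b≤a∨b , λ _ → ∨-≤
    where
    x≤y⇒x∨y≡y : ∀ {x y} → x ≤ y → x ∨ y ≡ y
    x≤y⇒x∨y≡y {x} {y} x≤y = trans (cong (_∨ y) (sym x≤y))
      (trans (∨-comm (x ∧ y) y) (trans (cong (y ∨_) (∧-comm x y)) (∨-absorbs-∧ y x)))
    x∨y≡y⇒x≤y : ∀ {x y} → x ∨ y ≡ y → x ≤ y
    x∨y≡y⇒x≤y {x} {y} x∨y≡y = trans (cong (x ∧_) (sym x∨y≡y)) (∧-absorbs-∨ x y)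
    b≤a∨b : b ≤ a ∨ b
    b≤a∨b = trans (cong (b ∧_) (∨-comm a b)) (∧-absorbs-∨ b a)
    ∨-≤ : ∀ {c} → a ≤ c → b ≤ c → a ∨ b ≤ c
    ∨-≤ {c} a≤c b≤c = x∨y≡y⇒x≤y
      (trans (∨-assoc a b c) (trans (cong (a ∨_) (x≤y⇒x∨y≡y b≤c)) (x≤y⇒x∨y≡y a≤c)))

  boundedLattice : BoundedLattice 0ℓ 0ℓ 0ℓ
  boundedLattice = record
    { isBoundedLattice = record
      { isLattice = record
        { isPartialOrder = ≤-isPartialOrder
        ; supremum       = ∨-supremum
        ; infimum        = ∧-infimum
        }
      ; maximum = top-greatest
      ; minimum = bot-least
      }
    }

  open BoundedLattice boundedLattice public
    using (poset; x∧y≤x; x∧y≤y; ∧-greatest)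
    renaming (refl to ≤-refl; trans to ≤-trans; antisym to ≤-antisym; reflexive to ≤-reflexive)

  ·-monoˡ : ∀ {a b} c → a ≤ b → a · c ≤ b · c
  ·-monoˡ {a} {b} c a≤b = unresiduate a c (b · c) (≤-trans a≤b (residuate b c (b · c) ≤-refl))

  ·-mono : ∀ {a a′ b b′} → a ≤ a′ → b ≤ b′ → a · b ≤ a′ · b′
  ·-mono {a} {a′} {b} {b′} a≤a′ b≤b′ =
    ≤-trans (·-monoˡ b a≤a′) (subst₂ _≤_ (·-comm b a′) (·-comm b′ a′) (·-monoˡ a′ b≤b′))

  id-isNucleus : IsNucleus A (λ a → a)
  id-isNucleus = (λ _ → ≤-refl) , (λ _ _ a≤b → a≤b) , (λ _ → refl) , (λ _ _ → ≤-refl)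

  const-top-isNucleus : IsNucleus A (λ _ → top)
  const-top-isNucleus = top-greatest , (λ _ _ _ → ≤-refl) , (λ _ → refl) , (λ _ _ → top-greatest _)

  isNucleus-resp-≗ : ∀ {f g} → f ≗ g → IsNucleus A g → IsNucleus A f
  isNucleus-resp-≗ {f} {g} f≗g (inflationary , monotone , idempotent , multiplicative) =
      (λ a → subst (a ≤_) (sym (f≗g a)) (inflationary a))
    , (λ a b a≤b → subst₂ _≤_ (sym (f≗g a)) (sym (f≗g b)) (monotone a b a≤b))
    , (λ a → begin
        f (f a)   ≡⟨ f≗g (f a) ⟩
        g (f a)   ≡⟨ cong g (f≗g a) ⟩
        g (g a)   ≡⟨ idempotent a ⟩
        g a       ≡⟨ f≗g a ⟨
        f a       ∎)
    , (λ a b → subst₂ _≤_ (sym (cong₂ _·_ (f≗g a) (f≗g b))) (sym (f≗g (a · b)))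
                          (multiplicative a b))
    where open ≡-Reasoning

module HeytingProperties (A : ResLattice) (heyting : IsHeyting A) where
  open ResLattice A
  open ResLatticeProperties A

  ·≗∧ : ∀ a b → a · b ≡ a ∧ b
  ·≗∧ a b = ≤-antisym
    (∧-greatest (subst (a · b ≤_) (·-identity a) (·-mono ≤-refl (top-greatest b)))
                (subst (a · b ≤_) (trans (·-comm top b) (·-identity b))
                       (·-mono (top-greatest a) ≤-refl)))
    (subst (_≤ a · b) (heyting (a ∧ b)) (·-mono (x∧y≤x a b) (x∧y≤y a b)))

  heytingAlgebra : HeytingAlgebra 0ℓ 0ℓ 0ℓ
  heytingAlgebra = record
    { Carrier          = Carrier
    ; _≈_              = _≡_
    ; _≤_              = _≤_
    ; _∨_              = _∨_
    ; _∧_              = _∧_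
    ; _⇨_              = _⇒_
    ; ⊤                = top
    ; ⊥                = bot
    ; isHeytingAlgebra = record
      { isBoundedLattice = BoundedLattice.isBoundedLattice boundedLattice
      ; exponential      = λ a b c →
            residuate a b c ∘ subst (_≤ c) (sym (·≗∧ a b))
          , subst (_≤ c) (·≗∧ a b) ∘ unresiduate a b c
      }
    }

  open HeytingAlgebra heytingAlgebra using (transpose-⇨)
  open HeytingAlgebraProperties heytingAlgebra
    using (⇨-eval; ⇨-app; ⇨-unit; y≤x⇨y; ⇨ʳ-covariant; ⇨ˡ-contravariant; ∧-distribˡ-∨;
           x≤¬¬x; de-morgan₁; de-morgan₂)
  open MeetSemilatticeProperties (BoundedLattice.meetSemilattice boundedLattice)
    using (∧-monotonic)
  open JoinSemilatticeProperties (BoundedLattice.joinSemilattice boundedLattice)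
    using (∨-idempotent)
  open BoundedLatticeProperties boundedLattice using (∧-zeroʳ; ∨-zeroˡ; ∨-zeroʳ)
  open BoundedMeetSemilatticeProperties (BoundedLattice.boundedMeetSemilattice boundedLattice)
    using () renaming (identityˡ to ∧-identityˡ)
  open BoundedJoinSemilatticeProperties (BoundedLattice.boundedJoinSemilattice boundedLattice)
    using () renaming (identityˡ to ∨-identityˡ; identityʳ to ∨-identityʳ)

  ⇒-top : ∀ {a b} → a ≤ b → (a ⇒ b) ≡ top
  ⇒-top {a} a≤b = ≤-antisym (top-greatest _) (transpose-⇨ (≤-trans (x∧y≤y top a) a≤b))

  top-⇒ : ∀ a → (top ⇒ a) ≡ a
  top-⇒ a = ≤-antisym (≤-trans (≤-reflexive (sym (top-greatest (top ⇒ a)))) ⇨-eval) y≤x⇨y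

  ¬-antitone : ∀ {a b} → a ≤ b → ¬ b ≤ ¬ a
  ¬-antitone = ⇨ˡ-contravariant

  ¬¬¬ : ∀ a → ¬ ¬ ¬ a ≡ ¬ a
  ¬¬¬ a = ≤-antisym (¬-antitone (x≤¬¬x a)) (x≤¬¬x (¬ a))

  ¬¬-distrib-∧ : ∀ a b → ¬ ¬ (a ∧ b) ≡ ¬ ¬ a ∧ ¬ ¬ b
  ¬¬-distrib-∧ a b = begin
    ¬ ¬ (a ∧ b)           ≡⟨ cong ¬_ (de-morgan₂ a b) ⟩
    ¬ ¬ ¬ (¬ a ∨ ¬ b)     ≡⟨ ¬¬¬ (¬ a ∨ ¬ b) ⟩
    ¬ (¬ a ∨ ¬ b)         ≡⟨ de-morgan₁ (¬ a) (¬ b) ⟩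
    ¬ ¬ a ∧ ¬ ¬ b         ∎
    where open ≡-Reasoning

  ¬¬-isNucleus : IsNucleus A (λ a → ¬ ¬ a)
  ¬¬-isNucleus =
      x≤¬¬x
    , (λ _ _ a≤b → ¬-antitone (¬-antitone a≤b))
    , (λ a → ¬¬¬ (¬ a))
    , (λ a b → ≤-reflexive (begin
        ¬ ¬ a · ¬ ¬ b   ≡⟨ ·≗∧ (¬ ¬ a) (¬ ¬ b) ⟩
        ¬ ¬ a ∧ ¬ ¬ b   ≡⟨ ¬¬-distrib-∧ a b ⟨
        ¬ ¬ (a ∧ b)     ≡⟨ cong (λ c → ¬ ¬ c) (·≗∧ a b) ⟨
        ¬ ¬ (a · b)     ∎))
    where open ≡-Reasoning

  ¬¬-∧-⇒ : ∀ a → ¬ ¬ a ∧ (¬ ¬ a ⇒ a) ≡ a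
  ¬¬-∧-⇒ a = begin
    ¬ ¬ a ∧ (¬ ¬ a ⇒ a)   ≡⟨ ∧-comm (¬ ¬ a) (¬ ¬ a ⇒ a) ⟩
    (¬ ¬ a ⇒ a) ∧ ¬ ¬ a   ≡⟨ ⇨-app ⟩
    a ∧ ¬ ¬ a             ≡⟨ x≤¬¬x a ⟩
    a                     ∎
    where open ≡-Reasoning

  ¬¬⇒-dense : ∀ a → ¬ (¬ ¬ a ⇒ a) ≡ bot
  ¬¬⇒-dense a = ≤-antisym
    (≤-trans (∧-greatest (¬-antitone ¬a≤¬¬a⇒a) (¬-antitone y≤x⇨y)) ⇨-eval)
    (bot-least _)
    where
    ¬a≤¬¬a⇒a : ¬ a ≤ (¬ ¬ a ⇒ a)
    ¬a≤¬¬a⇒a = ≤-trans (x≤¬¬x (¬ a)) (⇨ʳ-covariant (bot-least a))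

  infix 4 _≈[_]_
  _≈[_]_ : Carrier → Carrier → Carrier → Set
  a ≈[ c ] b = c ∧ a ≡ c ∧ b

  ∧-distribˡ-∧ : ∀ c a b → c ∧ (a ∧ b) ≡ (c ∧ a) ∧ (c ∧ b)
  ∧-distribˡ-∧ c a b = ≤-antisym
    (∧-greatest (∧-monotonic ≤-refl (x∧y≤x a b)) (∧-monotonic ≤-refl (x∧y≤y a b)))
    (∧-greatest (≤-trans (x∧y≤x _ _) (x∧y≤x c a)) (∧-monotonic (x∧y≤y c a) (x∧y≤y c b)))

  ∧-⇒-restrict : ∀ c a b → c ∧ (a ⇒ b) ≡ c ∧ (c ∧ a ⇒ c ∧ b)
  ∧-⇒-restrict c a b = ≤-antisym
    (∧-greatest (x∧y≤x c _) (transpose-⇨ (∧-greatest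
      (≤-trans (x∧y≤x _ _) (x∧y≤x c _))
      (≤-trans (∧-monotonic (x∧y≤y c _) (x∧y≤y c a)) ⇨-eval))))
    (∧-greatest (x∧y≤x c _) (transpose-⇨ (begin
      (c ∧ (c ∧ a ⇒ c ∧ b)) ∧ a    ≤⟨ ∧-greatest (≤-trans (x∧y≤x _ a) (x∧y≤y c _))
                                                 (∧-monotonic (x∧y≤x c _) ≤-refl) ⟩
      (c ∧ a ⇒ c ∧ b) ∧ (c ∧ a)    ≤⟨ ⇨-eval ⟩
      c ∧ b                        ≤⟨ x∧y≤y c b ⟩
      b                            ∎)))
    where open ≤-Reasoning poset

  ≈[]-cong₂ : ∀ {c} (_•_ F : Op₂ Carrier) → (∀ a b → c ∧ (a • b) ≡ F (c ∧ a) (c ∧ b)) →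
              ∀ {a a′ b b′} → a ≈[ c ] a′ → b ≈[ c ] b′ → a • b ≈[ c ] a′ • b′
  ≈[]-cong₂ _•_ F local {a} {a′} {b} {b′} a≈a′ b≈b′ =
    trans (local a b) (trans (cong₂ F a≈a′ b≈b′) (sym (local a′ b′)))

  ⟦⟧-resp-≈[] : ∀ {X : Set} {c} (t : Term X) {ρ ρ′ : X → Carrier} →
                (∀ v → ρ v ≈[ c ] ρ′ v) → ⟦ t ⟧ A ρ ≈[ c ] ⟦ t ⟧ A ρ′
  ⟦⟧-resp-≈[] (var v) ρ≈ρ′ = ρ≈ρ′ v
  ⟦⟧-resp-≈[] {c = c} (s ∧ₜ u) ρ≈ρ′ =
    ≈[]-cong₂ _∧_ _∧_ (∧-distribˡ-∧ c) (⟦⟧-resp-≈[] s ρ≈ρ′) (⟦⟧-resp-≈[] u ρ≈ρ′)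
  ⟦⟧-resp-≈[] {c = c} (s ∨ₜ u) ρ≈ρ′ =
    ≈[]-cong₂ _∨_ _∨_ (∧-distribˡ-∨ c) (⟦⟧-resp-≈[] s ρ≈ρ′) (⟦⟧-resp-≈[] u ρ≈ρ′)
  ⟦⟧-resp-≈[] {c = c} (s ·ₜ u) ρ≈ρ′ =
    ≈[]-cong₂ _·_ _∧_ (λ a b → trans (cong (c ∧_) (·≗∧ a b)) (∧-distribˡ-∧ c a b))
      (⟦⟧-resp-≈[] s ρ≈ρ′) (⟦⟧-resp-≈[] u ρ≈ρ′)
  ⟦⟧-resp-≈[] {c = c} (s ⇒ₜ u) ρ≈ρ′ =
    ≈[]-cong₂ _⇒_ (λ a b → c ∧ (a ⇒ b)) (∧-⇒-restrict c) (⟦⟧-resp-≈[] s ρ≈ρ′) (⟦⟧-resp-≈[] u ρ≈ρ′)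
  ⟦⟧-resp-≈[] ⊥ₜ _ = refl
  ⟦⟧-resp-≈[] ⊤ₜ _ = refl

  embed₃ : Carrier → Chain₃ → Carrier
  embed₃ d ⊥₃ = bot
  embed₃ d ½₃ = d
  embed₃ d ⊤₃ = top

  embed₃-∧ : ∀ {d} i j → embed₃ d i ∧ embed₃ d j ≡ embed₃ d (i ∧₃ j)
  embed₃-∧     ⊥₃ j  = bot-least _
  embed₃-∧ {d} ½₃ ⊥₃ = ∧-zeroʳ d
  embed₃-∧ {d} ½₃ ½₃ = ∧-idem d
  embed₃-∧ {d} ½₃ ⊤₃ = top-greatest d
  embed₃-∧     ⊤₃ j  = ∧-identityˡ _

  embed₃-∨ : ∀ {d} i j → embed₃ d i ∨ embed₃ d j ≡ embed₃ d (i ∨₃ j)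
  embed₃-∨     ⊥₃ j  = ∨-identityˡ _
  embed₃-∨ {d} ½₃ ⊥₃ = ∨-identityʳ d
  embed₃-∨ {d} ½₃ ½₃ = ∨-idempotent d
  embed₃-∨ {d} ½₃ ⊤₃ = ∨-zeroʳ d
  embed₃-∨     ⊤₃ j  = ∨-zeroˡ _

  module _ {d : Carrier} (d-dense : ¬ d ≡ bot) where
    embed₃-⇒ : ∀ i j → (embed₃ d i ⇒ embed₃ d j) ≡ embed₃ d (i ⇒₃ j)
    embed₃-⇒ ⊥₃ j  = ⇒-top (bot-least _)
    embed₃-⇒ ½₃ ⊥₃ = d-dense
    embed₃-⇒ ½₃ ½₃ = ⇨-unit
    embed₃-⇒ ½₃ ⊤₃ = ⇒-top (top-greatest d)
    embed₃-⇒ ⊤₃ j  = top-⇒ _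

    ⟦⟧-embed₃ : ∀ {X : Set} (t : Term X) (σ : X → Chain₃) →
                ⟦ t ⟧ A (embed₃ d ∘ σ) ≡ embed₃ d (⟦ t ⟧₃ σ)
    ⟦⟧-embed₃ (var v)  σ = refl
    ⟦⟧-embed₃ (s ∧ₜ u) σ =
      trans (cong₂ _∧_ (⟦⟧-embed₃ s σ) (⟦⟧-embed₃ u σ)) (embed₃-∧ (⟦ s ⟧₃ σ) (⟦ u ⟧₃ σ))
    ⟦⟧-embed₃ (s ∨ₜ u) σ =
      trans (cong₂ _∨_ (⟦⟧-embed₃ s σ) (⟦⟧-embed₃ u σ)) (embed₃-∨ (⟦ s ⟧₃ σ) (⟦ u ⟧₃ σ))
    ⟦⟧-embed₃ (s ·ₜ u) σ =
      trans (cong₂ _·_ (⟦⟧-embed₃ s σ) (⟦⟧-embed₃ u σ))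
            (trans (·≗∧ _ _) (embed₃-∧ (⟦ s ⟧₃ σ) (⟦ u ⟧₃ σ)))
    ⟦⟧-embed₃ (s ⇒ₜ u) σ =
      trans (cong₂ _⇒_ (⟦⟧-embed₃ s σ) (⟦⟧-embed₃ u σ)) (embed₃-⇒ (⟦ s ⟧₃ σ) (⟦ u ⟧₃ σ))
    ⟦⟧-embed₃ ⊥ₜ       σ = refl
    ⟦⟧-embed₃ ⊤ₜ       σ = refl

  module InflationaryMonotoneTerm
    (t : UnaryTerm)
    (inflationary : ∀ a → a ≤ op t A a)
    (monotone : ∀ a b → a ≤ b → op t A a ≤ op t A b)
    where

    γ : Carrier → Carrier
    γ = op t A

    γ-embed₃ : ∀ {d} → ¬ d ≡ bot → ∀ {i j} → t at₃ i ≡ j → γ (embed₃ d i) ≡ embed₃ d j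
    γ-embed₃ d-dense {i} refl = ⟦⟧-embed₃ d-dense t (λ _ → i)

    γ-bot : ∀ {i} → t at₃ ⊥₃ ≡ i → γ bot ≡ embed₃ top i
    γ-bot = γ-embed₃ (top-⇒ bot)

    γ≡top : γ bot ≡ top → ∀ a → γ a ≡ top
    γ≡top γ⊥≡⊤ a = ≤-antisym (top-greatest _) (subst (_≤ γ a) γ⊥≡⊤ (monotone bot a (bot-least a)))

    module _ (γ⊥≡⊥ : γ bot ≡ bot) (a : Carrier) where
      γ≤¬¬ : γ a ≤ ¬ ¬ a
      γ≤¬¬ = transpose-⇨ (≤-reflexive (begin
        γ a ∧ ¬ a       ≡⟨ ∧-comm (γ a) (¬ a) ⟩
        ¬ a ∧ γ a       ≡⟨ ⟦⟧-resp-≈[] t (λ _ → a≈[¬a]⊥) ⟩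
        ¬ a ∧ γ bot     ≡⟨ cong (¬ a ∧_) γ⊥≡⊥ ⟩
        ¬ a ∧ bot       ≡⟨ ∧-zeroʳ (¬ a) ⟩
        bot             ∎))
        where
        open ≡-Reasoning
        a≈[¬a]⊥ : a ≈[ ¬ a ] bot
        a≈[¬a]⊥ = trans ⇨-app (trans (bot-least a) (sym (∧-zeroʳ (¬ a))))

      γ-decomposition : ∀ {j} → t at₃ ½₃ ≡ j → γ a ≡ ¬ ¬ a ∧ embed₃ (¬ ¬ a ⇒ a) j
      γ-decomposition {j} t½≡j = begin
        γ a                       ≡⟨ γ≤¬¬ ⟨
        γ a ∧ ¬ ¬ a               ≡⟨ ∧-comm (γ a) (¬ ¬ a) ⟩
        ¬ ¬ a ∧ γ a               ≡⟨ ⟦⟧-resp-≈[] t (λ _ → a≈[¬¬a]d) ⟩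
        ¬ ¬ a ∧ γ (¬ ¬ a ⇒ a)     ≡⟨ cong (¬ ¬ a ∧_) (γ-embed₃ (¬¬⇒-dense a) t½≡j) ⟩
        ¬ ¬ a ∧ embed₃ (¬ ¬ a ⇒ a) j ∎
        where
        open ≡-Reasoning
        a≈[¬¬a]d : a ≈[ ¬ ¬ a ] (¬ ¬ a ⇒ a)
        a≈[¬¬a]d = trans (trans (∧-comm (¬ ¬ a) a) (x≤¬¬x a)) (sym (¬¬-∧-⇒ a))

    γ≗normalForm : ∀ {i j} → t at₃ ⊥₃ ≡ i → t at₃ ½₃ ≡ j → γ ≗ op (nucleusNormalForm i j) A
    γ≗normalForm {½₃} t⊥ _ = γ≡top (γ-bot t⊥)
    γ≗normalForm {⊤₃} t⊥ _ = γ≡top (γ-bot t⊥)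
    γ≗normalForm {⊥₃} {⊥₃} t⊥ t½ a = ≤-antisym γa≤a (inflationary a)
      where
      γa≤a : γ a ≤ a
      γa≤a = subst (_≤ a) (sym (trans (γ-decomposition (γ-bot t⊥) a t½) (∧-zeroʳ _))) (bot-least a)
    γ≗normalForm {⊥₃} {½₃} t⊥ t½ a = trans (γ-decomposition (γ-bot t⊥) a t½) (¬¬-∧-⇒ a)
    γ≗normalForm {⊥₃} {⊤₃} t⊥ t½ a = trans (γ-decomposition (γ-bot t⊥) a t½) (top-greatest (¬ ¬ a))

isNucleusOn⇒≈normalForm : ∀ {V} t → IsNucleusOn V t →
                          V ⊨ᵤ t ≈ nucleusNormalForm (t at₃ ⊥₃) (t at₃ ½₃)
isNucleusOn⇒≈normalForm t t-nucleus A A∈V@(heyting , _) =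
  let inflationary , monotone , _ = t-nucleus A A∈V
  in  InflationaryMonotoneTerm.γ≗normalForm t inflationary monotone refl refl
  where open HeytingProperties A heyting

≈normalForm-cases : ∀ {V} t i j → V ⊨ᵤ t ≈ nucleusNormalForm i j →
                    (V ⊨ᵤ t ≈ x) ⊎ (V ⊨ᵤ t ≈ ¬¬x) ⊎ (V ⊨ᵤ t ≈ ⊤ₜ)
≈normalForm-cases _ ⊥₃ ⊥₃ = inj₁
≈normalForm-cases _ ⊥₃ ½₃ = inj₁
≈normalForm-cases _ ⊥₃ ⊤₃ = inj₂ ∘ inj₁
≈normalForm-cases _ ½₃ _  = inj₂ ∘ inj₂
≈normalForm-cases _ ⊤₃ _  = inj₂ ∘ inj₂

isNucleusOn-resp-≈ : ∀ {V} t s → V ⊨ᵤ t ≈ s → IsNucleusOn V s → IsNucleusOn V t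
isNucleusOn-resp-≈ _ _ t≈s s-nucleus A A∈V =
  ResLatticeProperties.isNucleus-resp-≗ A (t≈s A A∈V) (s-nucleus A A∈V)

x-isNucleusOn : ∀ {V} → IsNucleusOn V x
x-isNucleusOn A _ = ResLatticeProperties.id-isNucleus A

¬¬x-isNucleusOn : ∀ {V} → IsNucleusOn V ¬¬x
¬¬x-isNucleusOn A (heyting , _) = HeytingProperties.¬¬-isNucleus A heyting

⊤ₜ-isNucleusOn : ∀ {V} → IsNucleusOn V ⊤ₜ
⊤ₜ-isNucleusOn A _ = ResLatticeProperties.const-top-isNucleus A

mainTheorem10 : (V : SubvarietyOfH) (t : UnaryTerm) →
    (IsNucleusOn V t → (V ⊨ᵤ t ≈ x) ⊎ (V ⊨ᵤ t ≈ ¬¬x) ⊎ (V ⊨ᵤ t ≈ ⊤ₜ))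
    × ((V ⊨ᵤ t ≈ x) ⊎ (V ⊨ᵤ t ≈ ¬¬x) ⊎ (V ⊨ᵤ t ≈ ⊤ₜ) → IsNucleusOn V t)
mainTheorem10 V t = nucleus⇒normal , normal⇒nucleus
  where
  nucleus⇒normal : IsNucleusOn V t → (V ⊨ᵤ t ≈ x) ⊎ (V ⊨ᵤ t ≈ ¬¬x) ⊎ (V ⊨ᵤ t ≈ ⊤ₜ)
  nucleus⇒normal = ≈normalForm-cases t (t at₃ ⊥₃) (t at₃ ½₃) ∘ isNucleusOn⇒≈normalForm t

  normal⇒nucleus : (V ⊨ᵤ t ≈ x) ⊎ (V ⊨ᵤ t ≈ ¬¬x) ⊎ (V ⊨ᵤ t ≈ ⊤ₜ) → IsNucleusOn V t
  normal⇒nucleus (inj₁ t≈x)         = isNucleusOn-resp-≈ t x t≈x x-isNucleusOn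
  normal⇒nucleus (inj₂ (inj₁ t≈¬¬x)) = isNucleusOn-resp-≈ t ¬¬x t≈¬¬x ¬¬x-isNucleusOn
  normal⇒nucleus (inj₂ (inj₂ t≈⊤))  = isNucleusOn-resp-≈ t ⊤ₜ t≈⊤ ⊤ₜ-isNucleusOn
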